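{- For every large $n$ there is a set $E$ of $\approx n$ points in $\mathbb{R}^3$ such that the number of pairs $(y,z)\in E^2$ with $\angle(0,y,z)=\pi/2$ (where $0$ is the origin) is $\approx n^2$.
   Context: $\angle(x,y,z)\in[0,\pi]$ denotes the angle at $y$ between $x-y$ and $z-y$ (for $x\ne y\ne z$). $X\approx Y$ means $cY\le X\le CY$ for all $n>N$ with positive constants $c,C,N$ independent of $n$. -}

module Defs where

open import Data.Rational using (ℚ; 0ℚ; _+_; _-_; _*_)
open import Data.Rational.Properties using (_≟_)
open import Data.Product using (_×_; _,_)
open import Data.Product.Properties using (≡-dec)
open import Data.List using (List; filter; cartesianProduct; length)
open import Data.Nat using (ℕ)
open import Relation.Nullary using (Dec; ¬_; _×-dec_; ¬?)
open import Relation.Binary.PropositionalEquality using (_≡_; _≢_)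
open import Relation.Binary.Definitions using (DecidableEquality)

Point : Set
Point = ℚ × ℚ × ℚ

origin : Point
origin = (0ℚ , 0ℚ , 0ℚ)

_≟ₚ_ : DecidableEquality Point
_≟ₚ_ = ≡-dec _≟_ (≡-dec _≟_ _≟_)

_−ₚ_ : Point → Point → Point
(a₁ , a₂ , a₃) −ₚ (b₁ , b₂ , b₃) = (a₁ - b₁ , a₂ - b₂ , a₃ - b₃)

dot : Point → Point → ℚ
dot (a₁ , a₂ , a₃) (b₁ , b₂ , b₃) = a₁ * b₁ + a₂ * b₂ + a₃ * b₃

-- ∠(x,y,z) = π/2 : defined for x ≠ y ≠ z, and (since cos ∠ = 0)
-- equivalent to the vanishing of the inner product (x−y)·(z−y).
RightAngle : Point → Point → Point → Set
RightAngle x y z = (x ≢ y) × (y ≢ z) × (dot (x −ₚ y) (z −ₚ y) ≡ 0ℚ)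

rightAngle? : ∀ x y z → Dec (RightAngle x y z)
rightAngle? x y z = ¬? (x ≟ₚ y) ×-dec (¬? (y ≟ₚ z) ×-dec (dot (x −ₚ y) (z −ₚ y) ≟ 0ℚ))

rightPairCount : List Point → ℕ
rightPairCount E =
  length (filter (λ p → rightAngle? origin (Data.Product.proj₁ p) (Data.Product.proj₂ p))
                 (cartesianProduct E E))

{-# OPTIONS --safe #-}
module Submission where

-- A point y sees the segment from 0 to z at a right angle iff y lies on the sphere with
-- diameter [0, z].  For every z on the line {(1, 0, c)} this sphere contains the circle with
-- diameter [0, (1, 0, 0)] in the plane x₃ = 0, so n rational points on that circle and n points
-- on the line give 2n points with at least n² right-angled pairs; at most (2n)² pairs exist.

open import Defs
open import Data.Nat using (ℕ; _>_; _^_)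
open import Data.Rational using (ℚ; 0ℚ; _<_; _≤_; _*_; _/_)
open import Data.Product using (Σ; ∃; _×_; _,_)
open import Data.Integer using (+_)
open import Data.List using (List; length)
open import Data.List.Relation.Unary.Unique.Propositional using (Unique)

import Data.Nat as ℕ
import Data.Nat.Properties as ℕP
open import Data.Nat.Coprimality using (1-coprimeTo) renaming (sym to coprime-sym)
open import Data.Nat.Solver using (module +-*-Solver)
import Data.Integer as ℤ
import Data.Integer.Properties as ℤP
import Data.Rational as ℚ
open import Data.Rational using (1ℚ; mkℚ; Positive; _-_; _+_; 1/_)
import Data.Rational.Properties as ℚP
import Data.Rational.Solver as ℚSolver
open import Data.List using ([]; _∷_; _++_; map; filter; cartesianProduct; upTo)
import Data.List.Properties as ListP
open import Data.List.Membership.Propositional using (_∈_)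
open import Data.List.Membership.Propositional.Properties using (∈-map⁻)
open import Data.List.Relation.Unary.All using (All)
import Data.List.Relation.Unary.All.Properties as AllP
import Data.List.Relation.Unary.Unique.Propositional.Properties as UniqueP
open import Data.List.Relation.Binary.Sublist.Propositional using (_⊆_; []; _∷_; _∷ʳ_; ⊆-refl)
open import Data.List.Relation.Binary.Sublist.Propositional.Properties
  using (++⁺; ++⁺ˡ; ++⁺ʳ; map⁺; filter⁺; length-mono-≤)
open import Data.Product using (proj₁; proj₂)
open import Data.Empty using (⊥)
open import Function using (_∘_)
open import Level using (0ℓ)
open import Relation.Nullary using (Dec; ¬_)
open import Relation.Unary using (Pred)
open import Relation.Binary.PropositionalEquality

fromℕ : ℕ → ℚ
fromℕ n = mkℚ (+ n) 0 (coprime-sym (1-coprimeTo n))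

n/1≡fromℕ : ∀ n → + n / 1 ≡ fromℕ n
n/1≡fromℕ n = ℚP.normalize-coprime (coprime-sym (1-coprimeTo n))

fromℕ-injective : ∀ {m n} → fromℕ m ≡ fromℕ n → m ≡ n
fromℕ-injective eq = ℤP.+-injective (cong ℚ.↥_ eq)

fromℕ-mono-≤ : ∀ {m n} → m ℕ.≤ n → fromℕ m ≤ fromℕ n
fromℕ-mono-≤ {m} {n} m≤n =
  ℚ.*≤* (subst₂ ℤ._≤_ (sym (ℤP.*-identityʳ (+ m))) (sym (ℤP.*-identityʳ (+ n))) (ℤ.+≤+ m≤n))

fromℕ-homo-* : ∀ m n → fromℕ m * fromℕ n ≡ fromℕ (m ℕ.* n)
fromℕ-homo-* m n = trans (cong (_/ 1) (ℤP.+◃n≡+n (m ℕ.* n))) (n/1≡fromℕ (m ℕ.* n))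

n/1-mono-≤ : ∀ {m n} → m ℕ.≤ n → + m / 1 ≤ + n / 1
n/1-mono-≤ {m} {n} rewrite n/1≡fromℕ m | n/1≡fromℕ n = fromℕ-mono-≤

n/1-homo-* : ∀ m n → (+ m / 1) * (+ n / 1) ≡ + (m ℕ.* n) / 1
n/1-homo-* m n rewrite n/1≡fromℕ m | n/1≡fromℕ n | n/1≡fromℕ (m ℕ.* n) = fromℕ-homo-* m n

*-n/1-≤ : ∀ a n {m} → a ℕ.* n ℕ.≤ m → (+ a / 1) * (+ n / 1) ≤ + m / 1
*-n/1-≤ a n an≤m rewrite n/1-homo-* a n = n/1-mono-≤ an≤m

≤-*-n/1 : ∀ a n {m} → m ℕ.≤ a ℕ.* n → + m / 1 ≤ (+ a / 1) * (+ n / 1)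
≤-*-n/1 a n m≤an rewrite n/1-homo-* a n = n/1-mono-≤ m≤an

*-cancelʳ-≡-pos : ∀ a .{{_ : Positive a}} {p q} → p * a ≡ q * a → p ≡ q
*-cancelʳ-≡-pos a eq = ℚP.≤-antisym (ℚP.*-cancelʳ-≤-pos a (ℚP.≤-reflexive eq))
                                    (ℚP.*-cancelʳ-≤-pos a (ℚP.≤-reflexive (sym eq)))

length-cartesianProduct : ∀ {A B : Set} (xs : List A) (ys : List B) →
                          length (cartesianProduct xs ys) ≡ length xs ℕ.* length ys
length-cartesianProduct []       ys = refl
length-cartesianProduct (x ∷ xs) ys = trans (ListP.length-++ (map (x ,_) ys))
  (cong₂ ℕ._+_ (ListP.length-map (x ,_) ys) (length-cartesianProduct xs ys))

length-map-upTo : ∀ {A : Set} (f : ℕ → A) n → length (map f (upTo n)) ≡ n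
length-map-upTo f n = trans (ListP.length-map f (upTo n)) (ListP.length-upTo n)

cartesianProduct-⊆ : ∀ {A B : Set} {xs xs′ : List A} {ys ys′ : List B} →
                     xs ⊆ xs′ → ys ⊆ ys′ → cartesianProduct xs ys ⊆ cartesianProduct xs′ ys′
cartesianProduct-⊆ []                   ys⊆ = []
cartesianProduct-⊆ {ys′ = ys′} (x ∷ʳ xs⊆) ys⊆ = ++⁺ˡ (map (x ,_) ys′) (cartesianProduct-⊆ xs⊆ ys⊆)
cartesianProduct-⊆ (refl ∷ xs⊆)         ys⊆ = ++⁺ (map⁺ _ ys⊆) (cartesianProduct-⊆ xs⊆ ys⊆)

module _ {A : Set} {P : Pred (A × A) 0ℓ} (P? : ∀ p → Dec (P p)) where

  length-filter-cartesianProduct-++-≥ : ∀ (ys zs : List A) → (∀ {y z} → y ∈ ys → z ∈ zs → P (y , z)) →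
    length ys ℕ.* length zs ℕ.≤ length (filter P? (cartesianProduct (ys ++ zs) (ys ++ zs)))
  length-filter-cartesianProduct-++-≥ ys zs yz-related = begin
    length ys ℕ.* length zs                              ≡⟨ length-cartesianProduct ys zs ⟨
    length (cartesianProduct ys zs)                      ≡⟨ cong length (ListP.filter-all P? all-related) ⟨
    length (filter P? (cartesianProduct ys zs))          ≤⟨ length-mono-≤ (filter⁺ P? P? (λ { refl p → p }) sub) ⟩
    length (filter P? (cartesianProduct (ys ++ zs) (ys ++ zs))) ∎
    where
    open ℕP.≤-Reasoning
    all-related : All P (cartesianProduct ys zs)
    all-related = AllP.cartesianProduct⁺ (setoid A) (setoid A) ys zs yz-related
    sub : cartesianProduct ys zs ⊆ cartesianProduct (ys ++ zs) (ys ++ zs)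
    sub = cartesianProduct-⊆ (++⁺ʳ zs (⊆-refl {x = ys})) (++⁺ˡ ys (⊆-refl {x = zs}))

rightPairCount-≤ : ∀ E → rightPairCount E ℕ.≤ length E ℕ.* length E
rightPairCount-≤ E = ℕP.≤-trans (ListP.length-filter _ (cartesianProduct E E))
                                (ℕP.≤-reflexive (length-cartesianProduct E E))

1+r² : ℚ → ℚ
1+r² r = 1ℚ + r * r

1+r²-positive : ∀ r .{{_ : Positive r}} → Positive (1+r² r)
1+r²-positive r = ℚP.pos+pos⇒pos 1ℚ (r * r) {{ℚP.pos*pos⇒pos r r}}

1/[1+r²] : (r : ℚ) .{{_ : Positive r}} → ℚ
1/[1+r²] r = (1/ 1+r² r) {{ℚP.pos⇒nonZero (1+r² r) {{1+r²-positive r}}}}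

1/[1+r²]-positive : ∀ r .{{_ : Positive r}} → Positive (1/[1+r²] r)
1/[1+r²]-positive r = ℚP.1/pos⇒pos (1+r² r) {{1+r²-positive r}}

1/[1+r²]*[1+r²]≡1 : ∀ r .{{_ : Positive r}} → 1/[1+r²] r * 1+r² r ≡ 1ℚ
1/[1+r²]*[1+r²]≡1 r = ℚP.*-inverseˡ (1+r² r) {{ℚP.pos⇒nonZero (1+r² r) {{1+r²-positive r}}}}

-- The point of slope r on the circle x₁² + x₂² = x₁ of the plane x₃ = 0.
circlePoint : (r : ℚ) .{{_ : Positive r}} → Point
circlePoint r = (1/[1+r²] r , r * 1/[1+r²] r , 0ℚ)

linePoint : ℚ → Point
linePoint c = (1ℚ , 0ℚ , c)

circlePoint-injective : ∀ {r s} .{{_ : Positive r}} .{{_ : Positive s}} →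
                        circlePoint r ≡ circlePoint s → r ≡ s
circlePoint-injective {r} {s} eq = *-cancelʳ-≡-pos (1/[1+r²] r) {{1/[1+r²]-positive r}} (begin
  r * 1/[1+r²] r ≡⟨ cong (proj₁ ∘ proj₂) eq ⟩
  s * 1/[1+r²] s ≡⟨ cong (s *_) (cong proj₁ eq) ⟨
  s * 1/[1+r²] r ∎)
  where open ≡-Reasoning

circlePoint-orthogonal : ∀ r .{{_ : Positive r}} c →
  dot (origin −ₚ circlePoint r) (linePoint c −ₚ circlePoint r) ≡ 0ℚ
circlePoint-orthogonal r c = begin
  dot (origin −ₚ circlePoint r) (linePoint c −ₚ circlePoint r)
    ≡⟨ solve 3 (λ a r c → ((con 0ℚ :- a) :* (con 1ℚ :- a)) :+ ((con 0ℚ :- r :* a) :* (con 0ℚ :- r :* a))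
                          :+ ((con 0ℚ :- con 0ℚ) :* (c :- con 0ℚ))
                   := a :* (a :* (con 1ℚ :+ r :* r)) :- a) refl a r c ⟩
  a * (a * 1+r² r) - a ≡⟨ cong (λ x → a * x - a) (1/[1+r²]*[1+r²]≡1 r) ⟩
  a * 1ℚ - a           ≡⟨ solve 1 (λ a → a :* con 1ℚ :- a := con 0ℚ) refl a ⟩
  0ℚ ∎
  where
  open ≡-Reasoning
  open ℚSolver.+-*-Solver
  a = 1/[1+r²] r

circlePoint-rightAngle : ∀ r .{{_ : Positive r}} c → c ≢ 0ℚ →
                         RightAngle origin (circlePoint r) (linePoint c)
circlePoint-rightAngle r c c≢0 = origin≢y , y≢z , circlePoint-orthogonal r c
  where
  origin≢y : origin ≢ circlePoint r
  origin≢y eq = ℚP.<-irrefl (cong proj₁ eq) (ℚP.positive⁻¹ (1/[1+r²] r) {{1/[1+r²]-positive r}})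
  y≢z : circlePoint r ≢ linePoint c
  y≢z eq = c≢0 (sym (cong (proj₂ ∘ proj₂) eq))

circleFamily lineFamily : ℕ → Point
circleFamily s = circlePoint (fromℕ (ℕ.suc s))
lineFamily t = linePoint (fromℕ (ℕ.suc t))

circleFamily-injective : ∀ {s t} → circleFamily s ≡ circleFamily t → s ≡ t
circleFamily-injective = ℕP.suc-injective ∘ fromℕ-injective ∘ circlePoint-injective

lineFamily-injective : ∀ {s t} → lineFamily s ≡ lineFamily t → s ≡ t
lineFamily-injective = ℕP.suc-injective ∘ fromℕ-injective ∘ cong (proj₂ ∘ proj₂)

circleFamily≢lineFamily : ∀ s t → circleFamily s ≢ lineFamily t
circleFamily≢lineFamily s t eq with cong (proj₂ ∘ proj₂) eq
... | ()

configuration : ℕ → List Point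
configuration n = map circleFamily (upTo n) ++ map lineFamily (upTo n)

length-configuration : ∀ n → length (configuration n) ≡ 2 ℕ.* n
length-configuration n = begin
  length (configuration n)                 ≡⟨ ListP.length-++ (map circleFamily (upTo n)) ⟩
  length (map circleFamily (upTo n)) ℕ.+ length (map lineFamily (upTo n))
    ≡⟨ cong₂ ℕ._+_ (length-map-upTo circleFamily n) (length-map-upTo lineFamily n) ⟩
  n ℕ.+ n                                  ≡⟨ cong (n ℕ.+_) (ℕP.+-identityʳ n) ⟨
  2 ℕ.* n ∎
  where open ≡-Reasoning

configuration-unique : ∀ n → Unique (configuration n)
configuration-unique n = UniqueP.++⁺ (UniqueP.map⁺ circleFamily-injective (UniqueP.upTo⁺ n))
                                     (UniqueP.map⁺ lineFamily-injective (UniqueP.upTo⁺ n)) disjoint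
  where
  disjoint : ∀ {v} → ¬ (v ∈ map circleFamily (upTo n) × v ∈ map lineFamily (upTo n))
  disjoint {v} (v∈ys , v∈zs) = separate (∈-map⁻ circleFamily v∈ys) (∈-map⁻ lineFamily v∈zs)
    where
    separate : ∃ (λ s → s ∈ upTo n × v ≡ circleFamily s) → ∃ (λ t → t ∈ upTo n × v ≡ lineFamily t) → ⊥
    separate (s , _ , v≡y) (t , _ , v≡z) = circleFamily≢lineFamily s t (trans (sym v≡y) v≡z)

circleFamily-rightAngle-lineFamily : ∀ {n y z} → y ∈ map circleFamily (upTo n) → z ∈ map lineFamily (upTo n) →
                                     RightAngle origin y z
circleFamily-rightAngle-lineFamily {y = y} {z} y∈ys z∈zs = pair (∈-map⁻ circleFamily y∈ys) (∈-map⁻ lineFamily z∈zs)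
  where
  pair : ∃ (λ s → _ × y ≡ circleFamily s) → ∃ (λ t → _ × z ≡ lineFamily t) → RightAngle origin y z
  pair (s , _ , y≡) (t , _ , z≡) = subst₂ (RightAngle origin) (sym y≡) (sym z≡)
    (circlePoint-rightAngle (fromℕ (ℕ.suc s)) (fromℕ (ℕ.suc t)) λ ())

rightPairCount-configuration-≥ : ∀ n → n ^ 2 ℕ.≤ rightPairCount (configuration n)
rightPairCount-configuration-≥ n = begin
  n ^ 2    ≡⟨ cong (n ℕ.*_) (ℕP.*-identityʳ n) ⟩
  n ℕ.* n  ≡⟨ cong₂ ℕ._*_ (length-map-upTo circleFamily n) (length-map-upTo lineFamily n) ⟨
  length (map circleFamily (upTo n)) ℕ.* length (map lineFamily (upTo n))
    ≤⟨ length-filter-cartesianProduct-++-≥ (λ p → rightAngle? origin (proj₁ p) (proj₂ p))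
         (map circleFamily (upTo n)) (map lineFamily (upTo n)) (circleFamily-rightAngle-lineFamily {n}) ⟩
  rightPairCount (configuration n) ∎
  where open ℕP.≤-Reasoning

rightPairCount-configuration-≤ : ∀ n → rightPairCount (configuration n) ℕ.≤ 4 ℕ.* n ^ 2
rightPairCount-configuration-≤ n = begin
  rightPairCount (configuration n)                     ≤⟨ rightPairCount-≤ (configuration n) ⟩
  length (configuration n) ℕ.* length (configuration n) ≡⟨ cong₂ ℕ._*_ (length-configuration n) (length-configuration n) ⟩
  2 ℕ.* n ℕ.* (2 ℕ.* n)                                 ≡⟨ solve 1 (λ m → con 2 :* m :* (con 2 :* m) := con 4 :* m :^ 2) refl n ⟩
  4 ℕ.* n ^ 2 ∎
  where
  open ℕP.≤-Reasoning
  open +-*-Solver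

theorem6p1 : Σ ℚ λ c₁ → Σ ℚ λ C₁ → Σ ℚ λ c₂ → Σ ℚ λ C₂ → Σ ℕ λ N →
    (0ℚ < c₁) × (0ℚ < C₁) × (0ℚ < c₂) × (0ℚ < C₂) ×
    ((n : ℕ) → n > N → Σ (List Point) λ E → Unique E ×
      (c₁ * (+ n / 1) ≤ (+ length E / 1)) × ((+ length E / 1) ≤ C₁ * (+ n / 1)) ×
      (c₂ * (+ (n ^ 2) / 1) ≤ (+ rightPairCount E / 1)) × ((+ rightPairCount E / 1) ≤ C₂ * (+ (n ^ 2) / 1)))
theorem6p1 = + 1 / 1 , + 2 / 1 , + 1 / 1 , + 4 / 1 , 0 ,
  ℚP.positive⁻¹ _ , ℚP.positive⁻¹ _ , ℚP.positive⁻¹ _ , ℚP.positive⁻¹ _ ,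
  λ n _ → configuration n , configuration-unique n ,
    *-n/1-≤ 1 n (ℕP.≤-trans (ℕP.*-monoˡ-≤ n (ℕP.n≤1+n 1)) (ℕP.≤-reflexive (sym (length-configuration n)))) ,
    ≤-*-n/1 2 n (ℕP.≤-reflexive (length-configuration n)) ,
    *-n/1-≤ 1 (n ^ 2) (ℕP.≤-trans (ℕP.≤-reflexive (ℕP.*-identityˡ (n ^ 2))) (rightPairCount-configuration-≥ n)) ,
    ≤-*-n/1 4 (n ^ 2) (rightPairCount-configuration-≤ n)
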